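{- For every monitoring tree $\tau$, $\mathsf{innerprune}(\tau)$ is a sub-monitoring tree of $\tau$ that contains no impossible nodes, and only impossible nodes of $\tau$ are removed by $\mathsf{innerprune}$.
   Context: A configuration is a triple $(\Sigma,\Delta,\mathcal U)$, where $\Delta$ assigns to each contract $c$ a failing map $\mathsf{failmap}_c$ from transaction identifiers to $\{\mathrm{None},\mathrm{Fail},\mathrm{Commit},\mathrm{Undecided}\}$. A monitoring tree is a finite rooted directed tree whose nodes are configurations; each internal node $n$ has one or two children, all edges out of $n$ are labelled by the same transaction $\mathsf{nextTx}(n)$, and two children are distinguished as committing successor and failing successor, rooting the committing subtree and the failing subtree of $n$. The futures of a node are the leaves reachable from it. For a leaf $l$ and transaction $t$: $\mathrm{MC}(l,t)=\{c:\mathsf{failmap}_c(t)\neq\mathrm{None}\}$ in $l$; the monitor of $t$ is known to commit at $l$ ($\mathsf{allMonitoringCommit}(l,t)$) iff all $c\in\mathrm{MC}(l,t)$ have $\mathsf{failmap}_c(t)=\mathrm{Commit}$; it is known to fail at $l$ ($\mathsf{oneMonitoringFail}(l,t)$) iff some $c\in\mathrm{MC}(l,t)$ has $\mathsf{failmap}_c(t)=\mathrm{Fail}$. Impossible nodes: for a branching node $n$ with $t=\mathsf{nextTx}(n)$, if in all possible futures in the committing subtree of $n$ the monitor of $t$ is known to commit, then all nodes of the failing subtree of $n$ are impossible; if in all possible futures in the committing subtree of $n$ the monitor of $t$ is known to fail, then all nodes of the committing subtree of $n$ are impossible (here possible futures are taken after impossible nodes below have been discarded). $\mathsf{innerprune}(\tau)$: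 if $\tau$ is a leaf return $\tau$; with $t=\mathsf{nextTx}(\mathrm{root})$, a root with one successor subtree $\tau_1$ is returned with the single child $\mathsf{innerprune}(\tau_1)$; a root with committing/failing subtrees $\tau_c,\tau_f$: let $\tau'_c=\mathsf{innerprune}(\tau_c)$, $\tau'_f=\mathsf{innerprune}(\tau_f)$; if all leaves $l$ of $\tau'_c$ satisfy $\mathsf{allMonitoringCommit}(l,t)$ return the root with only child $\tau'_c$; else if all leaves $l$ of $\tau'_c$ satisfy $\mathsf{oneMonitoringFail}(l,t)$ return the root with only child $\tau'_f$; otherwise return the root with children $\tau'_c,\tau'_f$. -}

module Defs where

open import Data.List using (List; []; _∷_)
open import Data.List.Relation.Unary.All using (All; all?)
open import Data.List.Relation.Unary.Any using (Any; any?)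
open import Data.Maybe using (Maybe; just; nothing)
open import Data.Product using (Σ; _×_; _,_)
open import Data.Sum using (_⊎_)
open import Data.Empty using (⊥)
open import Data.Unit using (⊤)
open import Relation.Nullary using (¬_; Dec; yes; no; ¬?)
open import Relation.Nullary.Decidable using (_×-dec_; _→-dec_)
open import Relation.Binary.PropositionalEquality using (_≡_; _≢_; refl)

data Status : Set where
  None Fail Commit Undecided : Status

_≟S_ : (a b : Status) → Dec (a ≡ b)
None ≟S None = yes refl
None ≟S Fail = no λ ()
None ≟S Commit = no λ ()
None ≟S Undecided = no λ ()
Fail ≟S None = no λ ()
Fail ≟S Fail = yes refl
Fail ≟S Commit = no λ ()
Fail ≟S Undecided = no λ ()
Commit ≟S None = no λ ()
Commit ≟S Fail = no λ ()
Commit ≟S Commit = yes refl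
Commit ≟S Undecided = no λ ()
Undecided ≟S None = no λ ()
Undecided ≟S Fail = no λ ()
Undecided ≟S Commit = no λ ()
Undecided ≟S Undecided = yes refl

-- Abstract setting: configurations (Σ,Δ,U) are abstract; all we use is
-- Δ, i.e. the (finite) list of contracts of a configuration and, for each
-- contract c, its failing map failmap_c : Tx → Status.
record Model : Set₁ where
  field
    Config   : Set
    Contract : Set
    Tx       : Set
    contracts : Config → List Contract
    failmap  : Config → Contract → Tx → Status

-- Monitoring trees: nodes are configurations; an internal node has either
-- one child, or a committing and a failing child; all out-edges carry the
-- same transaction nextTx.
data MTree (Config Tx : Set) : Set where
  leaf  : Config → MTree Config Tx
  node1 : Config → Tx → MTree Config Tx → MTree Config Tx
  node2 : Config → Tx → (committing failing : MTree Config Tx) → MTree Config Tx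

data Dir : Set where
  dS dC dF : Dir

Path : Set
Path = List Dir

module _ {Config Tx : Set} where

  nodeAt : MTree Config Tx → Path → Maybe (MTree Config Tx)
  nodeAt τ [] = just τ
  nodeAt (node1 _ _ τ₁) (dS ∷ q) = nodeAt τ₁ q
  nodeAt (node2 _ _ τc _) (dC ∷ q) = nodeAt τc q
  nodeAt (node2 _ _ _ τf) (dF ∷ q) = nodeAt τf q
  nodeAt _ (_ ∷ _) = nothing

  Valid : MTree Config Tx → Path → Set
  Valid τ [] = ⊤
  Valid (node1 _ _ τ₁) (dS ∷ q) = Valid τ₁ q
  Valid (node2 _ _ τc _) (dC ∷ q) = Valid τc q
  Valid (node2 _ _ _ τf) (dF ∷ q) = Valid τf q
  Valid _ (_ ∷ _) = ⊥

  AllLeaves : (Config → Set) → MTree Config Tx → Set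
  AllLeaves P (leaf l) = P l
  AllLeaves P (node1 _ _ τ₁) = AllLeaves P τ₁
  AllLeaves P (node2 _ _ τc τf) = AllLeaves P τc × AllLeaves P τf

  allLeaves? : {P : Config → Set} → (∀ l → Dec (P l)) → ∀ τ → Dec (AllLeaves P τ)
  allLeaves? P? (leaf l) = P? l
  allLeaves? P? (node1 _ _ τ₁) = allLeaves? P? τ₁
  allLeaves? P? (node2 _ _ τc τf) = allLeaves? P? τc ×-dec allLeaves? P? τf

  -- sub-monitoring trees: same root, obtained by removing subtrees
  -- (a branching node may lose one of its two children).
  data Sub : MTree Config Tx → MTree Config Tx → Set where
    sub-leaf : ∀ {n} → Sub (leaf n) (leaf n)
    sub-one  : ∀ {n t a a'} → Sub a a' → Sub (node1 n t a) (node1 n t a')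
    sub-both : ∀ {n t a a' b b'} → Sub a a' → Sub b b' → Sub (node2 n t a b) (node2 n t a' b')
    sub-C    : ∀ {n t a a' b'} → Sub a a' → Sub (node1 n t a) (node2 n t a' b')
    sub-F    : ∀ {n t b a' b'} → Sub b b' → Sub (node1 n t b) (node2 n t a' b')

  Kept : {s τ : MTree Config Tx} → Sub s τ → Path → Set
  Kept _ [] = ⊤
  Kept (sub-one r) (dS ∷ q) = Kept r q
  Kept (sub-both r _) (dC ∷ q) = Kept r q
  Kept (sub-both _ r) (dF ∷ q) = Kept r q
  Kept (sub-C r) (dC ∷ q) = Kept r q
  Kept (sub-F r) (dF ∷ q) = Kept r q
  Kept _ (_ ∷ _) = ⊥

module _ (M : Model) where
  open Model M

  MonitoredBy : Config → Tx → Contract → Set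
  MonitoredBy l t c = failmap l c t ≢ None

  allMonitoringCommit : Config → Tx → Set
  allMonitoringCommit l t =
    All (λ c → MonitoredBy l t c → failmap l c t ≡ Commit) (contracts l)

  oneMonitoringFail : Config → Tx → Set
  oneMonitoringFail l t =
    Any (λ c → MonitoredBy l t c × failmap l c t ≡ Fail) (contracts l)

  allMonitoringCommit? : ∀ l t → Dec (allMonitoringCommit l t)
  allMonitoringCommit? l t =
    all? (λ c → ¬? (failmap l c t ≟S None) →-dec (failmap l c t ≟S Commit)) (contracts l)

  oneMonitoringFail? : ∀ l t → Dec (oneMonitoringFail l t)
  oneMonitoringFail? l t =
    any? (λ c → ¬? (failmap l c t ≟S None) ×-dec (failmap l c t ≟S Fail)) (contracts l)

  -- At a branching node with nextTx t, the nodes of the failing subtree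
  -- are impossible if every possible leaf (leaf not impossible within the
  -- committing subtree) of the committing subtree knows the monitor of t
  -- commits; the nodes of the committing subtree are impossible if every
  -- such leaf knows it fails.
  Impossible : MTree Config Tx → Path → Set
  Impossible (leaf _) _ = ⊥
  Impossible _ [] = ⊥
  Impossible (node1 _ _ τ₁) (dS ∷ q) = Impossible τ₁ q
  Impossible (node2 _ t τc τf) (dF ∷ q) =
    (Valid τf q ×
      (∀ q' l → nodeAt τc q' ≡ just (leaf l) → ¬ Impossible τc q' → allMonitoringCommit l t))
    ⊎ Impossible τf q
  Impossible (node2 _ t τc τf) (dC ∷ q) =
    (Valid τc q ×
      (∀ q' l → nodeAt τc q' ≡ just (leaf l) → ¬ Impossible τc q' → oneMonitoringFail l t))
    ⊎ Impossible τc q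
  Impossible (node1 _ _ _) (dC ∷ _) = ⊥
  Impossible (node1 _ _ _) (dF ∷ _) = ⊥
  Impossible (node2 _ _ _ _) (dS ∷ _) = ⊥

  innerprune : MTree Config Tx → MTree Config Tx
  innerprune (leaf l) = leaf l
  innerprune (node1 n t τ₁) = node1 n t (innerprune τ₁)
  innerprune (node2 n t τc τf)
    with allLeaves? (λ l → allMonitoringCommit? l t) (innerprune τc)
  ... | yes _ = node1 n t (innerprune τc)
  ... | no _ with allLeaves? (λ l → oneMonitoringFail? l t) (innerprune τc)
  ...   | yes _ = node1 n t (innerprune τf)
  ...   | no _ = node2 n t (innerprune τc) (innerprune τf)

-- innerprune tests its pruning condition on the leaves of the already pruned
-- committing subtree, whereas impossibility quantifies over the possible
-- leaves of the unpruned one.  The two agree because, inductively, the pruned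
-- subtree keeps precisely the possible nodes: every removed node is impossible
-- (so every possible leaf is kept) and no kept node is impossible.
module Submission where

open import Defs
open import Data.Empty using (⊥-elim)
open import Data.List using ([]; _∷_)
open import Data.Maybe using (just)
open import Data.Product using (Σ; _×_; _,_)
open import Data.Sum using (inj₁; inj₂)
open import Data.Unit using (tt)
open import Relation.Binary.PropositionalEquality using (_≡_; refl)
open import Relation.Nullary using (¬_; Dec; yes; no)

module _ {Config Tx : Set} where

  nodeAt⇒Valid : ∀ (τ : MTree Config Tx) q {x} → nodeAt τ q ≡ just x → Valid τ q
  nodeAt⇒Valid τ [] _ = tt
  nodeAt⇒Valid (leaf _) (_ ∷ _) ()
  nodeAt⇒Valid (node1 _ _ a) (dS ∷ q) e = nodeAt⇒Valid a q e
  nodeAt⇒Valid (node1 _ _ _) (dC ∷ _) ()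
  nodeAt⇒Valid (node1 _ _ _) (dF ∷ _) ()
  nodeAt⇒Valid (node2 _ _ _ _) (dS ∷ _) ()
  nodeAt⇒Valid (node2 _ _ a _) (dC ∷ q) e = nodeAt⇒Valid a q e
  nodeAt⇒Valid (node2 _ _ _ b) (dF ∷ q) e = nodeAt⇒Valid b q e

  kept? : ∀ {s τ : MTree Config Tx} (r : Sub s τ) q → Dec (Kept r q)
  kept? _ [] = yes tt
  kept? (sub-one r) (dS ∷ q) = kept? r q
  kept? (sub-both r _) (dC ∷ q) = kept? r q
  kept? (sub-both _ r) (dF ∷ q) = kept? r q
  kept? (sub-C r) (dC ∷ q) = kept? r q
  kept? (sub-F r) (dF ∷ q) = kept? r q
  kept? sub-leaf (_ ∷ _) = no λ ()
  kept? (sub-one _) (dC ∷ _) = no λ ()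
  kept? (sub-one _) (dF ∷ _) = no λ ()
  kept? (sub-both _ _) (dS ∷ _) = no λ ()
  kept? (sub-C _) (dS ∷ _) = no λ ()
  kept? (sub-C _) (dF ∷ _) = no λ ()
  kept? (sub-F _) (dS ∷ _) = no λ ()
  kept? (sub-F _) (dC ∷ _) = no λ ()

  AllLeaves⇒kept-leaf : ∀ {P : Config → Set} {s τ : MTree Config Tx} (r : Sub s τ) q {l} →
    nodeAt τ q ≡ just (leaf l) → Kept r q → AllLeaves P s → P l
  AllLeaves⇒kept-leaf sub-leaf [] refl _ p = p
  AllLeaves⇒kept-leaf (sub-one r) (dS ∷ q) e k p = AllLeaves⇒kept-leaf r q e k p
  AllLeaves⇒kept-leaf (sub-both r _) (dC ∷ q) e k (p , _) = AllLeaves⇒kept-leaf r q e k p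
  AllLeaves⇒kept-leaf (sub-both _ r) (dF ∷ q) e k (_ , p) = AllLeaves⇒kept-leaf r q e k p
  AllLeaves⇒kept-leaf (sub-C r) (dC ∷ q) e k p = AllLeaves⇒kept-leaf r q e k p
  AllLeaves⇒kept-leaf (sub-F r) (dF ∷ q) e k p = AllLeaves⇒kept-leaf r q e k p
  AllLeaves⇒kept-leaf (sub-one _) [] () _ _
  AllLeaves⇒kept-leaf (sub-both _ _) [] () _ _
  AllLeaves⇒kept-leaf (sub-C _) [] () _ _
  AllLeaves⇒kept-leaf (sub-F _) [] () _ _

  leaves⇒AllLeaves : ∀ {P : Config → Set} (τ : MTree Config Tx) →
    (∀ q l → nodeAt τ q ≡ just (leaf l) → P l) → AllLeaves P τ
  leaves⇒AllLeaves (leaf l) h = h [] l refl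
  leaves⇒AllLeaves (node1 _ _ a) h = leaves⇒AllLeaves a (λ q → h (dS ∷ q))
  leaves⇒AllLeaves (node2 _ _ a b) h =
    leaves⇒AllLeaves a (λ q → h (dC ∷ q)) , leaves⇒AllLeaves b (λ q → h (dF ∷ q))

module _ (M : Model) where
  open Model M

  private
    T : Set
    T = MTree Config Tx

  NoImpossible : T → Set
  NoImpossible s = ∀ p → ¬ Impossible M s p

  OnlyImpossibleRemoved : {s τ : T} → Sub s τ → Set
  OnlyImpossibleRemoved {τ = τ} r = ∀ p → Valid τ p → ¬ Kept r p → Impossible M τ p

  AllPossibleLeaves : (Config → Set) → T → Set
  AllPossibleLeaves P τ = ∀ q l → nodeAt τ q ≡ just (leaf l) → ¬ Impossible M τ q → P l

  Pruning : T → T → Set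
  Pruning s τ = Σ (Sub s τ) λ r → NoImpossible s × OnlyImpossibleRemoved r

  AllLeaves⇒AllPossibleLeaves : ∀ {P s τ} → Pruning s τ → AllLeaves P s → AllPossibleLeaves P τ
  AllLeaves⇒AllPossibleLeaves {τ = τ} (r , _ , removed) all q l e possible with kept? r q
  ... | yes k = AllLeaves⇒kept-leaf r q e k all
  ... | no k = ⊥-elim (possible (removed q (nodeAt⇒Valid τ q e) k))

  AllPossibleLeaves⇒AllLeaves : ∀ {P s} → NoImpossible s → AllPossibleLeaves P s → AllLeaves P s
  AllPossibleLeaves⇒AllLeaves {s = s} none all = leaves⇒AllLeaves s λ q l e → all q l e (none q)

  node1-NoImpossible : ∀ {n t s} → NoImpossible s → NoImpossible (node1 n t s)
  node1-NoImpossible none (dS ∷ q) = none q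
  node1-NoImpossible _ [] ()
  node1-NoImpossible _ (dC ∷ _) ()
  node1-NoImpossible _ (dF ∷ _) ()

  leaf-Pruning : ∀ {l} → Pruning (leaf l) (leaf l)
  leaf-Pruning = sub-leaf , (λ _ ()) , λ { [] _ k → ⊥-elim (k tt) }

  node1-Pruning : ∀ {n t s τ} → Pruning s τ → Pruning (node1 n t s) (node1 n t τ)
  node1-Pruning (r , none , removed) = sub-one r , node1-NoImpossible none , removed′
    where
    removed′ : OnlyImpossibleRemoved (sub-one r)
    removed′ [] _ k = ⊥-elim (k tt)
    removed′ (dS ∷ q) = removed q

  commit-Pruning : ∀ {n t s c f} → AllLeaves (λ l → allMonitoringCommit M l t) s →
    Pruning s c → Pruning (node1 n t s) (node2 n t c f)
  commit-Pruning {f = f} commits pc@(r , none , removed) =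
    sub-C r , node1-NoImpossible none , removed′
    where
    removed′ : OnlyImpossibleRemoved (sub-C {b' = f} r)
    removed′ [] _ k = ⊥-elim (k tt)
    removed′ (dC ∷ q) v k = inj₂ (removed q v k)
    removed′ (dF ∷ q) v _ = inj₁ (v , AllLeaves⇒AllPossibleLeaves pc commits)

  fail-Pruning : ∀ {n t sc sf c f} → AllLeaves (λ l → oneMonitoringFail M l t) sc →
    Pruning sc c → Pruning sf f → Pruning (node1 n t sf) (node2 n t c f)
  fail-Pruning {c = c} fails pc (r , none , removed) =
    sub-F r , node1-NoImpossible none , removed′
    where
    removed′ : OnlyImpossibleRemoved (sub-F {a' = c} r)
    removed′ [] _ k = ⊥-elim (k tt)
    removed′ (dC ∷ q) v _ = inj₁ (v , AllLeaves⇒AllPossibleLeaves pc fails)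
    removed′ (dF ∷ q) v k = inj₂ (removed q v k)

  both-Pruning : ∀ {n t sc sf c f} →
    ¬ AllLeaves (λ l → allMonitoringCommit M l t) sc →
    ¬ AllLeaves (λ l → oneMonitoringFail M l t) sc →
    Pruning sc c → Pruning sf f → Pruning (node2 n t sc sf) (node2 n t c f)
  both-Pruning {n} {t} {sc} {sf} ¬commits ¬fails
    (rc , nonec , removedc) (rf , nonef , removedf) = sub-both rc rf , none , removed
    where
    none : NoImpossible (node2 n t sc sf)
    none (dC ∷ _) (inj₁ (_ , fails)) = ¬fails (AllPossibleLeaves⇒AllLeaves nonec fails)
    none (dC ∷ q) (inj₂ i) = nonec q i
    none (dF ∷ _) (inj₁ (_ , commits)) = ¬commits (AllPossibleLeaves⇒AllLeaves nonec commits)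
    none (dF ∷ q) (inj₂ i) = nonef q i
    none [] ()
    none (dS ∷ _) ()
    removed : OnlyImpossibleRemoved (sub-both rc rf)
    removed [] _ k = ⊥-elim (k tt)
    removed (dC ∷ q) v k = inj₂ (removedc q v k)
    removed (dF ∷ q) v k = inj₂ (removedf q v k)

  innerprune-Pruning : ∀ τ → Pruning (innerprune M τ) τ
  innerprune-Pruning (leaf _) = leaf-Pruning
  innerprune-Pruning (node1 _ _ τ) = node1-Pruning (innerprune-Pruning τ)
  innerprune-Pruning (node2 n t c f)
    with allLeaves? (λ l → allMonitoringCommit? M l t) (innerprune M c)
  ... | yes commits = commit-Pruning commits (innerprune-Pruning c)
  ... | no ¬commits with allLeaves? (λ l → oneMonitoringFail? M l t) (innerprune M c)
  ...   | yes fails = fail-Pruning fails (innerprune-Pruning c) (innerprune-Pruning f)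
  ...   | no ¬fails =
    both-Pruning ¬commits ¬fails (innerprune-Pruning c) (innerprune-Pruning f)

lemma3 : (M : Model) (τ : MTree (Model.Config M) (Model.Tx M)) →
    Σ (Sub (innerprune M τ) τ) (λ r →
    (∀ p → ¬ Impossible M (innerprune M τ) p) ×
    (∀ p → Valid τ p → ¬ Kept r p → Impossible M τ p))
lemma3 = innerprune-Pruning
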